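{- Let $G$ be an $(m,n)$-mixed graph, let $c$ be a simple colouring of $G$, and let $N \subseteq V(G)$ be such that $c(u)=i$ for all $u\in N$. Then $c(x)=i$ for all $x\in \mathrm{conv}(N)$.
   Context: An $(m,n)$-mixed graph $G=(V,A,E)$ is a simple graph (no loops, at most one adjacency between any pair of vertices) in which each adjacency is either an arc or an edge, with colour functions $c_A: A \to \{1,\dots,m\}$, $c_E: E \to \{1,\dots,n\}$. A simple colouring of $G$ is a simple homomorphism $c: G\to_s H$ to some $(m,n)$-mixed graph $H$, i.e. a map $V(G)\to V(H)$ such that either $|V(G)|=1$, or $c$ is non-constant and every adjacency $uv$ with $c(u)\neq c(v)$ is mapped to an adjacency of the same type (edge/arc, same direction, same colour). If $uv, wv$ are adjacencies of $G$, then $u$ and $w$ agree on $v$ if $uv, wv$ are both edges of the same colour, or both arcs towards $v$ of the same colour, or both arcs from $v$ of the same colour; otherwise $v$ is between $u$ and $w$. A set $C\subseteq V(G)$ is convex if for all $u,w\in C$ there is no $v\in V(G)\setminus C$ between $u$ and $w$. The convex hull $\mathrm{conv}(N)$ of $N\subseteq V(G)$ is the smallest convex set containing $N$. -}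

module Defs where

open import Data.Nat using (ℕ)
open import Data.Fin using (Fin)
open import Data.Fin.Subset using (Subset; _∈_; _∉_; _⊆_)
open import Data.Product using (_×_; ∃₂)
open import Data.Sum using (_⊎_)
open import Relation.Binary.PropositionalEquality using (_≡_; _≢_)
open import Relation.Nullary using (¬_)

-- The adjacency from u to v, seen from u:
--   none       : u and v are not adjacent
--   edge j     : uv is an edge of colour j
--   arcTo j    : there is an arc u → v of colour j
--   arcFrom j  : there is an arc v → u of colour j
data Adj (m n : ℕ) : Set where
  none    : Adj m n
  edge    : Fin n → Adj m n
  arcTo   : Fin m → Adj m n
  arcFrom : Fin m → Adj m n

rev : ∀ {m n} → Adj m n → Adj m n
rev none        = none
rev (edge j)    = edge j
rev (arcTo j)   = arcFrom j
rev (arcFrom j) = arcTo j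

-- A finite (m,n)-mixed graph on vertex set Fin k: simple (no loops,
-- at most one adjacency per pair, encoded by a single Adj value per
-- ordered pair, consistent in both directions).
record MixedGraph (m n : ℕ) : Set where
  field
    size    : ℕ
    adj     : Fin size → Fin size → Adj m n
    noLoop  : ∀ u → adj u u ≡ none
    adjSym  : ∀ u v → adj v u ≡ rev (adj u v)
open MixedGraph public

V : ∀ {m n} → MixedGraph m n → Set
V G = Fin (size G)

Adjacent : ∀ {m n} (G : MixedGraph m n) → V G → V G → Set
Adjacent G u v = adj G u v ≢ none

IsSimpleHom : ∀ {m n} (G H : MixedGraph m n) → (V G → V H) → Set
IsSimpleHom G H c =
  size G ≡ 1 ⊎
  ( (∃₂ λ u w → c u ≢ c w)
  × (∀ u v → Adjacent G u v → c u ≢ c v → adj H (c u) (c v) ≡ adj G u v))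

-- u and w agree on v (both adjacent to v): the adjacencies uv and wv are
-- of the same type, same colour, same direction relative to v.
Agree : ∀ {m n} (G : MixedGraph m n) → V G → V G → V G → Set
Agree G u w v = adj G u v ≡ adj G w v

Between : ∀ {m n} (G : MixedGraph m n) → V G → V G → V G → Set
Between G u w v = Adjacent G u v × Adjacent G w v × ¬ Agree G u w v

Convex : ∀ {m n} (G : MixedGraph m n) → Subset (size G) → Set
Convex G C = ∀ u w v → u ∈ C → w ∈ C → v ∉ C → ¬ Between G u w v

-- membership in the convex hull: belongs to every convex set containing N
-- (the smallest convex set containing N is the intersection of these)
InConv : ∀ {m n} (G : MixedGraph m n) → Subset (size G) → V G → Set
InConv G N x = ∀ (C : Subset (size G)) → Convex G C → N ⊆ C → x ∈ C

-- Every colour class of a simple colouring is convex: if u and w have the same colour and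
-- v does not, the adjacencies uv and wv are both carried onto the one adjacency between
-- c u and c v, so u and w agree on v. The hull of N lies in every convex set containing N,
-- in particular in the colour class of i.
module Submission where

open import Defs
open import Data.Bool using (true)
open import Data.Empty using (⊥-elim)
open import Data.Fin using (Fin; zero; _≟_)
open import Data.Fin.Subset using (Subset; _∈_)
open import Data.Product using (_,_)
open import Data.Sum using (inj₁; inj₂)
open import Data.Vec using (tabulate)
open import Data.Vec.Properties using (lookup∘tabulate; []=⇒lookup; lookup⇒[]=)
open import Level using (Level)
open import Relation.Binary.PropositionalEquality
  using (_≡_; _≢_; refl; sym; trans; subst; cong; module ≡-Reasoning)
open import Relation.Nullary using (¬_; Dec; yes; does)
open import Relation.Nullary.Decidable using (dec-true)
open import Relation.Unary using (Pred; Decidable)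

module _ {ℓ : Level} {k} {P : Pred (Fin k) ℓ} (P? : Decidable P) where

  subsetOf : Subset k
  subsetOf = tabulate (λ x → does (P? x))

  ∈-subsetOf⁺ : ∀ {x} → P x → x ∈ subsetOf
  ∈-subsetOf⁺ {x} px = lookup⇒[]= x subsetOf
    (trans (lookup∘tabulate _ x) (dec-true (P? x) px))

  ∈-subsetOf⁻ : ∀ {x} → x ∈ subsetOf → P x
  ∈-subsetOf⁻ {x} x∈ = does-true⇒ (P? x) (trans (sym (lookup∘tabulate _ x)) ([]=⇒lookup x∈))
    where
    does-true⇒ : ∀ {A : Set ℓ} (a? : Dec A) → does a? ≡ true → A
    does-true⇒ (yes a) _ = a

fin1-unique : (u v : Fin 1) → u ≡ v
fin1-unique zero zero = refl

module _ {m n} (G : MixedGraph m n) where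

  adjacent⇒≢ : ∀ {u v} → Adjacent G u v → u ≢ v
  adjacent⇒≢ {u} uv refl = uv (noLoop G u)

  size≡1⇒¬Adjacent : size G ≡ 1 → ∀ {u v} → ¬ Adjacent G u v
  size≡1⇒¬Adjacent size≡1 {u} {v} uv =
    adjacent⇒≢ uv (subst (λ k → (u v : Fin k) → u ≡ v) (sym size≡1) fin1-unique u v)

module _ {k l} (c : Fin k → Fin l) (i : Fin l) where

  fibre : Subset k
  fibre = subsetOf (λ x → c x ≟ i)

  ∈-fibre⁺ : ∀ {x} → c x ≡ i → x ∈ fibre
  ∈-fibre⁺ = ∈-subsetOf⁺ (λ x → c x ≟ i)

  ∈-fibre⁻ : ∀ {x} → x ∈ fibre → c x ≡ i
  ∈-fibre⁻ = ∈-subsetOf⁻ (λ x → c x ≟ i)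

module _ {m n} {G H : MixedGraph m n} {c : V G → V H} where

  open ≡-Reasoning

  simpleHom-agree : IsSimpleHom G H c → ∀ {u w v} → Adjacent G u v → Adjacent G w v →
    c u ≡ c w → c u ≢ c v → Agree G u w v
  simpleHom-agree (inj₁ size≡1) uv _ _ _ = ⊥-elim (size≡1⇒¬Adjacent G size≡1 uv)
  simpleHom-agree (inj₂ (_ , preserve)) {u} {w} {v} uv wv cu≡cw cu≢cv = begin
    adj G u v         ≡⟨ sym (preserve u v uv cu≢cv) ⟩
    adj H (c u) (c v) ≡⟨ cong (λ z → adj H z (c v)) cu≡cw ⟩
    adj H (c w) (c v) ≡⟨ preserve w v wv (λ cw≡cv → cu≢cv (trans cu≡cw cw≡cv)) ⟩
    adj G w v         ∎

  fibre-convex : IsSimpleHom G H c → ∀ i → Convex G (fibre c i)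
  fibre-convex hom i u w v u∈ w∈ v∉ (uv , wv , disagree) =
    disagree (simpleHom-agree hom uv wv (trans cu≡i (sym cw≡i)) cu≢cv)
    where
    cu≡i = ∈-fibre⁻ c i u∈
    cw≡i = ∈-fibre⁻ c i w∈
    cu≢cv : c u ≢ c v
    cu≢cv cu≡cv = v∉ (∈-fibre⁺ c i (trans (sym cu≡cv) cu≡i))

mainTheorem7 : ∀ {m n} (G H : MixedGraph m n) (c : V G → V H) → IsSimpleHom G H c →
    (N : Subset (size G)) (i : V H) → (∀ u → u ∈ N → c u ≡ i) →
    ∀ x → InConv G N x → c x ≡ i
mainTheorem7 G H c hom N i N⊆fibre x x∈conv =
  ∈-fibre⁻ c i (x∈conv (fibre c i) (fibre-convex {G = G} {H} hom i)
    (λ {u} u∈N → ∈-fibre⁺ c i (N⊆fibre u u∈N)))
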